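{- Let $n\geq1$ and let $\pi$ be a total cyclic order on $\{0,\ldots,n\}$. Then \[ E^*(S_\pi,z)=z^{\mathrm{des}(\underline{\pi})+1}. \]
   Context: A total cyclic order $\pi$ on $\{0,\ldots,n\}$ corresponds to a placement of the elements on a circle; $\underline{\pi}=(w_0,\ldots,w_n)$ is the word read clockwise from $w_0=0$, and $\mathrm{des}(\underline{\pi})$ is the number of $0\leq i\leq n-1$ with $w_{i+1}<w_i$. For $y\in[0,1)^n$, $\mathrm{cs}(y)$ is the unique word $(w_0,\ldots,w_n)$ of distinct letters of $\{0,\ldots,n\}$ with $w_0=0$ such that for $1\leq i<j\leq n$, $i$ appears after $j$ in the word iff $y_i>y_j$; $S_\pi=\{y\in[0,1)^n:\mathrm{cs}(y)=\underline{\pi}\}$. For a bounded set $S\subset[0,1)^n$, $E(S,t)=\#(tS\cap\mathbb{Z}^n)$ and $E^*(S,z)=(1-z)^{n+1}\sum_{t\geq1}E(S,t)z^t$. -}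

module Defs where

open import Data.Nat as ℕ using (ℕ; zero; suc; _∸_)
open import Data.Fin as Fin using (Fin; zero; suc; inject₁; toℕ)
open import Data.Fin.Properties using (any?; all?) renaming (_<?_ to _<ᶠ?_)
open import Data.Integer as ℤ using (ℤ; +_; -_)
open import Data.Rational as ℚ using (ℚ; _/_)
open import Data.Rational.Properties as ℚP using ()
open import Data.List using (List; []; _∷_; length; filter; concatMap; map)
open import Data.List.Base using (allFin)
open import Data.Vec.Functional using (Vector)
open import Data.Product using (Σ; ∃; _×_; _,_)
open import Data.Sum using (_⊎_)
open import Relation.Nullary using (¬_; Dec)
open import Relation.Nullary.Decidable using (_×-dec_; _→-dec_; _⊎-dec_)
open import Relation.Unary using (Pred; Decidable)
open import Relation.Binary.PropositionalEquality using (_≡_)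
open import Function.Definitions using (Injective)
open import Data.Fin using (_≟_)

record IsTotalCyclicOrder {X : Set} (R : X → X → X → Set) : Set where
  field
    cyclic     : ∀ {a b c} → R a b c → R b c a
    asymmetric : ∀ {a b c} → R a b c → ¬ R c b a
    transitive : ∀ {a b c d} → R a b c → R a c d → R a b d
    total      : ∀ {a b c} → ¬ a ≡ b → ¬ b ≡ c → ¬ a ≡ c → R a b c ⊎ R c b a

CyclicallyIncreasing : ∀ {m} → Fin m → Fin m → Fin m → Set
CyclicallyIncreasing i j k =
  (i Fin.< j × j Fin.< k) ⊎ (j Fin.< k × k Fin.< i) ⊎ (k Fin.< i × i Fin.< j)

-- A word (w₀,…,wₙ) of distinct letters of {0,…,n} with w₀ = 0
-- (given as the function position ↦ letter).
IsWordFrom0 : (n : ℕ) → (Fin (suc n) → Fin (suc n)) → Set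
IsWordFrom0 n w = Injective _≡_ _≡_ w × w zero ≡ zero

-- w is the word read clockwise from 0 of the cyclic order R:
-- w is a word from 0 and reading it around the circle gives R.
IsWordOf : (n : ℕ) → (Fin (suc n) → Fin (suc n) → Fin (suc n) → Set)
         → (Fin (suc n) → Fin (suc n)) → Set
IsWordOf n R w =
  IsWordFrom0 n w ×
  (∀ i j k → (R (w i) (w j) (w k) → CyclicallyIncreasing i j k)
           × (CyclicallyIncreasing i j k → R (w i) (w j) (w k)))

des : (n : ℕ) → (Fin (suc n) → Fin (suc n)) → ℕ
des n w = length (filter (λ i → w (suc i) <ᶠ? w (inject₁ i)) (allFin n))

-- cs(y) = w and S_π.  Coordinates y : Fin n → ℚ, coordinate i stands
-- for y_{i+1}, i.e. letter (suc i).

AppearsAfter : ∀ {m} → (Fin m → Fin m) → Fin m → Fin m → Set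
AppearsAfter w a b = ∃ λ p → ∃ λ q → w p ≡ a × w q ≡ b × q Fin.< p

CsIs : (n : ℕ) → Vector ℚ n → (Fin (suc n) → Fin (suc n)) → Set
CsIs n y w = ∀ (i j : Fin n) → i Fin.< j →
  (AppearsAfter w (suc i) (suc j) → y j ℚ.< y i) ×
  (y j ℚ.< y i → AppearsAfter w (suc i) (suc j))

-- y ∈ S_π  (π given by its word w)
InS : (n : ℕ) → (Fin (suc n) → Fin (suc n)) → Vector ℚ n → Set
InS n w y = (∀ i → (ℚ.0ℚ ℚ.≤ y i) × (y i ℚ.< ℚ.1ℚ)) × CsIs n y w

appearsAfter? : ∀ {m} (w : Fin m → Fin m) a b → Dec (AppearsAfter w a b)
appearsAfter? w a b =
  any? λ p → any? λ q → (w p ≟ a) ×-dec ((w q ≟ b) ×-dec (q <ᶠ? p))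

inS? : (n : ℕ) (w : Fin (suc n) → Fin (suc n)) → Decidable (InS n w)
inS? n w y =
  all? (λ i → (ℚ.0ℚ ℚP.≤? y i) ×-dec (y i ℚP.<? ℚ.1ℚ)) ×-dec
  all? (λ i → all? λ j → (i <ᶠ? j) →-dec
     ((appearsAfter? w (suc i) (suc j) →-dec (y j ℚP.<? y i)) ×-dec
      ((y j ℚP.<? y i) →-dec appearsAfter? w (suc i) (suc j))))

-- Lattice point enumerator E(S_π, t) = #(t S_π ∩ ℤⁿ), t ≥ 1.
-- Since S_π ⊆ [0,1)ⁿ, every point of t S_π ∩ ℤⁿ lies in {0,…,t-1}ⁿ,
-- so we enumerate x ∈ {0,…,t-1}ⁿ and test x/t ∈ S_π.

allVectors : (n t : ℕ) → List (Vector (Fin t) n)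
allVectors zero    t = (λ ()) ∷ []
allVectors (suc n) t =
  concatMap (λ a → map (λ v → λ { zero → a ; (suc i) → v i }) (allVectors n t))
            (allFin t)

scale : ∀ {n} (t : ℕ) → Vector (Fin (suc t)) n → Vector ℚ n
scale t x i = (+ toℕ (x i)) / suc t

E : (n : ℕ) → (Fin (suc n) → Fin (suc n)) → ℕ → ℕ
E n w zero    = 0
E n w (suc t) =
  length (filter (λ x → inS? n w (scale t x)) (allVectors n (suc t)))

Series : Set
Series = ℕ → ℤ

sumTo : ℕ → (ℕ → ℤ) → ℤ
sumTo zero    f = f 0
sumTo (suc k) f = sumTo k f ℤ.+ f (suc k)

_⊛_ : Series → Series → Series
(f ⊛ g) k = sumTo k (λ i → f i ℤ.* g (k ∸ i))

oneS : Series
oneS zero    = + 1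
oneS (suc _) = + 0

oneMinusZ : Series
oneMinusZ zero          = + 1
oneMinusZ (suc zero)    = - (+ 1)
oneMinusZ (suc (suc _)) = + 0

_^S_ : Series → ℕ → Series
f ^S zero  = oneS
f ^S suc m = f ⊛ (f ^S m)

zPow : ℕ → Series
zPow d k with d ℕ.≟ k
... | Relation.Nullary.yes _ = + 1
... | Relation.Nullary.no  _ = + 0

-- Σ_{t ≥ 1} E(S_π,t) z^t   (E n w 0 = 0)
EhrSeries : (n : ℕ) → (Fin (suc n) → Fin (suc n)) → Series
EhrSeries n w t = + E n w t

Estar : (n : ℕ) → (Fin (suc n) → Fin (suc n)) → Series
Estar n w = (oneMinusZ ^S suc n) ⊛ EhrSeries n w

module Submission where

open import Defs
open import Data.Nat using (ℕ; suc; _≤_)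
open import Data.Fin using (Fin)
open import Relation.Binary.PropositionalEquality using (_≡_)

-- Write n = m + 1 and let w = (w₀,…,wₙ) be the word of π, so w₀ = 0.  Position p+1
-- of w carries the letter of coordinate τ p.  Unfolding cs, a point y ∈ [0,1)ⁿ lies
-- in S_π iff its coordinates, read in the order of w, increase weakly, and strictly
-- exactly at the descents of w.  So, after reindexing coordinates by word position,
-- the lattice points of (t+1)·S_π are the chains 0 ≤ z₁ ≤ … ≤ zₙ ≤ t with forced
-- jumps at the d = des(w) descents; removing the jumps leaves weakly increasing
-- sequences, hence E(S_π, t) = ((t ∸ d multichoose n)) for every t.  Multiplying by
-- (1 - z)^(n+1) takes n+1 backward differences, and these leave exactly z^(d+1).
-- The cyclic order R plays no further role: S_π is determined by its word w.

module VectorSums where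

  open import Data.Nat using (ℕ; zero; suc; _*_)
  open import Data.Nat.Properties using (+-*-semiring)
  open import Data.Fin using (Fin; zero; suc; punchIn; punchOut)
  open import Data.Fin.Properties using (punchIn-punchOut; _≟_)
  open import Data.Fin.Permutation using (Permutation; _⟨$⟩ʳ_; _⟨$⟩ˡ_; remove; inverseʳ; punchIn-permute′)
  open import Data.Vec.Functional using (Vector; _∷_; insertAt)
  open import Data.Vec.Functional.Properties using (insertAt-lookup; insertAt-punchIn)
  open import Function using (_∘_)
  open import Relation.Nullary using (yes; no)
  open import Relation.Binary.PropositionalEquality
  open import Algebra.Properties.Semiring.Sum +-*-semiring using (sum; sum-cong-≗; ∑-comm; *-distribˡ-sum)

  ∑ᵛ : (T m : ℕ) → (Vector (Fin T) m → ℕ) → ℕ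
  ∑ᵛ T zero    f = f (λ ())
  ∑ᵛ T (suc m) f = sum (λ a → ∑ᵛ T m (λ v → f (a ∷ v)))

  -- f depends only on the entries of its argument (functions on Fin have no η for cases).
  Extensional : ∀ {T m} → (Vector (Fin T) m → ℕ) → Set
  Extensional f = ∀ {x y} → x ≗ y → f x ≡ f y

  ∑ᵛ-cong : ∀ T m {f g : Vector (Fin T) m → ℕ} → (∀ x → f x ≡ g x) → ∑ᵛ T m f ≡ ∑ᵛ T m g
  ∑ᵛ-cong T zero    f≗g = f≗g _
  ∑ᵛ-cong T (suc m) f≗g = sum-cong-≗ (λ a → ∑ᵛ-cong T m (λ v → f≗g (a ∷ v)))

  ∑ᵛ-*ˡ : ∀ T m c (f : Vector (Fin T) m → ℕ) → ∑ᵛ T m (λ x → c * f x) ≡ c * ∑ᵛ T m f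
  ∑ᵛ-*ˡ T zero    c f = refl
  ∑ᵛ-*ˡ T (suc m) c f = trans (sum-cong-≗ (λ a → ∑ᵛ-*ˡ T m c (λ v → f (a ∷ v))))
                              (sym (*-distribˡ-sum c (λ a → ∑ᵛ T m (λ v → f (a ∷ v)))))

  ≗-by-punchIn : ∀ {A : Set} {m} (k : Fin (suc m)) (u v : Vector A (suc m)) →
    u k ≡ v k → (∀ j → u (punchIn k j) ≡ v (punchIn k j)) → u ≗ v
  ≗-by-punchIn k u v at-k off-k i with k ≟ i
  ... | yes refl = at-k
  ... | no  k≢i  = subst (λ i → u i ≡ v i) (punchIn-punchOut k≢i) (off-k (punchOut k≢i))

  insertAt-cong : ∀ {A : Set} {m} (k : Fin (suc m)) (a : A) {x y : Vector A m} →
    x ≗ y → insertAt x k a ≗ insertAt y k a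
  insertAt-cong k a {x} {y} x≗y = ≗-by-punchIn k _ _
    (trans (insertAt-lookup x k a) (sym (insertAt-lookup y k a)))
    (λ j → trans (insertAt-punchIn x k a j) (trans (x≗y j) (sym (insertAt-punchIn y k a j))))

  ∷-cong : ∀ {A : Set} {m} (a : A) {x y : Vector A m} → x ≗ y → (a ∷ x) ≗ (a ∷ y)
  ∷-cong a x≗y zero    = refl
  ∷-cong a x≗y (suc j) = x≗y j

  ∑ᵛ-insertAt : ∀ T m (k : Fin (suc m)) (f : Vector (Fin T) (suc m) → ℕ) → Extensional f →
    ∑ᵛ T (suc m) f ≡ sum (λ a → ∑ᵛ T m (λ v → f (insertAt v k a)))
  ∑ᵛ-insertAt T m zero f ext =
    sum-cong-≗ (λ a → ∑ᵛ-cong T m (λ v →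
      ext {a ∷ v} {insertAt v zero a} λ { zero → refl ; (suc j) → refl }))
  ∑ᵛ-insertAt T (suc m) (suc k) f ext = begin
    sum (λ b → ∑ᵛ T (suc m) (λ v → f (b ∷ v)))
      ≡⟨ sum-cong-≗ (λ b → ∑ᵛ-insertAt T m k (λ v → f (b ∷ v)) (ext ∘ ∷-cong b)) ⟩
    sum (λ b → sum (λ a → ∑ᵛ T m (λ u → f (b ∷ insertAt u k a))))
      ≡⟨ ∑-comm (λ b a → ∑ᵛ T m (λ u → f (b ∷ insertAt u k a))) ⟩
    sum (λ a → sum (λ b → ∑ᵛ T m (λ u → f (b ∷ insertAt u k a))))
      ≡⟨ sum-cong-≗ (λ a → sum-cong-≗ (λ b → ∑ᵛ-cong T m (λ u →
           ext {b ∷ insertAt u k a} {insertAt (b ∷ u) (suc k) a}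
               λ { zero → refl ; (suc j) → refl }))) ⟩
    sum (λ a → ∑ᵛ T (suc m) (λ v → f (insertAt v (suc k) a))) ∎
    where open ≡-Reasoning

  ∑ᵛ-permute : ∀ T m (π : Permutation m m) (f : Vector (Fin T) m → ℕ) → Extensional f →
    ∑ᵛ T m f ≡ ∑ᵛ T m (λ z → f (z ∘ (π ⟨$⟩ʳ_)))
  ∑ᵛ-permute T zero    π f ext = ext (λ ())
  ∑ᵛ-permute T (suc m) π f ext = begin
    ∑ᵛ T (suc m) f
      ≡⟨ ∑ᵛ-insertAt T m k f ext ⟩
    sum (λ a → ∑ᵛ T m (λ v → f (insertAt v k a)))
      ≡⟨ sum-cong-≗ (λ a → ∑ᵛ-permute T m π′ _ (ext ∘ insertAt-cong k a)) ⟩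
    sum (λ a → ∑ᵛ T m (λ u → f (insertAt (u ∘ (π′ ⟨$⟩ʳ_)) k a)))
      ≡⟨ sum-cong-≗ (λ a → ∑ᵛ-cong T m (λ u → ext (insert≗permute a u))) ⟩
    ∑ᵛ T (suc m) (λ z → f (z ∘ (π ⟨$⟩ʳ_))) ∎
    where
    open ≡-Reasoning
    k  = π ⟨$⟩ˡ zero
    π′ = remove k π
    insert≗permute : ∀ {A : Set} (a : A) u → insertAt (u ∘ (π′ ⟨$⟩ʳ_)) k a ≗ (a ∷ u) ∘ (π ⟨$⟩ʳ_)
    insert≗permute a u = ≗-by-punchIn k _ _
      (trans (insertAt-lookup _ k a) (cong (a ∷ u) (sym (inverseʳ π))))
      (λ j → trans (insertAt-punchIn _ k a j) (cong (a ∷ u) (sym (punchIn-permute′ π zero j))))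

  ∑ᵛ-reindex : ∀ T m (π : Permutation m m) (f g : Vector (Fin T) m → ℕ) → Extensional f →
    (∀ z → f (z ∘ (π ⟨$⟩ʳ_)) ≡ g z) → ∑ᵛ T m f ≡ ∑ᵛ T m g
  ∑ᵛ-reindex T m π f g ext f∘π≗g = trans (∑ᵛ-permute T m π f ext) (∑ᵛ-cong T m f∘π≗g)

module Counting where

  open import Data.Nat using (ℕ; zero; suc; _+_)
  open import Data.Nat.Properties using (+-*-semiring; +-identityʳ)
  open import Data.Bool using (Bool; true; false)
  open import Data.Fin using (Fin; zero; suc)
  open import Data.List as List using (List; []; _++_; length; filter; map; concatMap; tabulate; allFin)
  open import Data.List.Properties using (length-++; filter-++)
  open import Data.Vec.Functional using (Vector; _∷_)
  open import Function using (id; _∘_)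
  open import Level using (0ℓ)
  open import Relation.Nullary using (does; yes; no; contradiction)
  open import Relation.Unary using (Pred; Decidable)
  open import Relation.Binary.PropositionalEquality
  open import Algebra.Properties.Semiring.Sum +-*-semiring using (sum; sum-cong-≗)
  open VectorSums

  𝟙 : Bool → ℕ
  𝟙 true  = 1
  𝟙 false = 0

  module _ {A : Set} {P : Pred A 0ℓ} (P? : Decidable P) where

    count : List A → ℕ
    count xs = length (filter P? xs)

    count-∷ : ∀ x xs → count (x List.∷ xs) ≡ 𝟙 (does (P? x)) + count xs
    count-∷ x xs with does (P? x)
    ... | true  = refl
    ... | false = refl

    count-++ : ∀ xs ys → count (xs ++ ys) ≡ count xs + count ys
    count-++ xs ys = trans (cong length (filter-++ P? xs ys)) (length-++ (filter P? xs))

    count-tabulate : ∀ {m} (h : Fin m → A) → count (tabulate h) ≡ sum (λ i → 𝟙 (does (P? (h i))))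
    count-tabulate {zero}  h = refl
    count-tabulate {suc m} h =
      trans (count-∷ (h zero) _) (cong (𝟙 (does (P? (h zero))) +_) (count-tabulate (λ i → h (suc i))))

    count-concatMap : ∀ {B : Set} {m} (g : B → List A) (h : Fin m → B) →
      count (concatMap g (tabulate h)) ≡ sum (λ i → count (g (h i)))
    count-concatMap {m = zero}  g h = refl
    count-concatMap {m = suc m} g h =
      trans (count-++ (g (h zero)) _) (cong (count (g (h zero)) +_) (count-concatMap g (λ i → h (suc i))))

  count-map : ∀ {A B : Set} {P : Pred A 0ℓ} (P? : Decidable P) (h : B → A) (xs : List B) →
    count P? (map h xs) ≡ count (λ x → P? (h x)) xs
  count-map P? h []       = refl
  count-map P? h (x List.∷ xs) with does (P? (h x))
  ... | true  = cong suc (count-map P? h xs)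
  ... | false = count-map P? h xs

  does-≗ : ∀ {m T} {P : Pred (Vector (Fin T) m) 0ℓ} (P? : Decidable P) →
    (∀ {x y} → x ≗ y → P x → P y) → ∀ {x y} → x ≗ y → does (P? x) ≡ does (P? y)
  does-≗ P? resp {x} {y} x≗y with P? x | P? y
  ... | yes _  | yes _  = refl
  ... | no  _  | no  _  = refl
  ... | yes px | no ¬py = contradiction (resp x≗y px) ¬py
  ... | no ¬px | yes py = contradiction (resp (sym ∘ x≗y) py) ¬px

  count-allVectors : ∀ n T {P : Pred (Vector (Fin T) n) 0ℓ} (P? : Decidable P) →
    (∀ {x y} → x ≗ y → P x → P y) →
    count P? (allVectors n T) ≡ ∑ᵛ T n (λ x → 𝟙 (does (P? x)))
  count-allVectors zero    T P? resp =
    trans (count-∷ P? _ []) (trans (+-identityʳ _) (cong 𝟙 (does-≗ P? resp λ ())))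
  count-allVectors (suc n) T P? resp = split-first _ λ { a v zero → refl ; a v (suc i) → refl }
    where
    split-first : (cons : Fin T → Vector (Fin T) n → Vector (Fin T) (suc n)) →
      (∀ a v → cons a v ≗ a ∷ v) →
      count P? (concatMap (λ a → map (cons a) (allVectors n T)) (allFin T))
        ≡ ∑ᵛ T (suc n) (λ x → 𝟙 (does (P? x)))
    split-first cons cons≗∷ = begin
      count P? (concatMap (λ a → map (cons a) (allVectors n T)) (tabulate id))
        ≡⟨ count-concatMap P? (λ a → map (cons a) (allVectors n T)) id ⟩
      sum (λ a → count P? (map (cons a) (allVectors n T)))
        ≡⟨ sum-cong-≗ (λ a → count-map P? (cons a) (allVectors n T)) ⟩
      sum (λ a → count (P? ∘ cons a) (allVectors n T))
        ≡⟨ sum-cong-≗ (λ a → count-allVectors n T (P? ∘ cons a) (λ x≗y → resp (cons-cong a x≗y))) ⟩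
      sum (λ a → ∑ᵛ T n (λ v → 𝟙 (does (P? (cons a v)))))
        ≡⟨ sum-cong-≗ (λ a → ∑ᵛ-cong T n (λ v → cong 𝟙 (does-≗ P? resp (cons≗∷ a v)))) ⟩
      ∑ᵛ T (suc n) (λ x → 𝟙 (does (P? x))) ∎
      where
      open ≡-Reasoning
      cons-cong : ∀ a {x y} → x ≗ y → cons a x ≗ cons a y
      cons-cong a {x} {y} x≗y i = begin
        cons a x i  ≡⟨ cons≗∷ a x i ⟩
        (a ∷ x) i   ≡⟨ ∷-cong a x≗y i ⟩
        (a ∷ y) i   ≡⟨ cons≗∷ a y i ⟨
        cons a y i  ∎

module Chains where

  open import Data.Nat using (ℕ; zero; suc; _+_; _*_; _∸_; _≤_; _<_; _≤?_; z≤n; s≤s)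
  open import Data.Nat.Properties
  open import Data.Bool using (Bool; true; false; _∧_)
  open import Data.Fin using (Fin; zero; suc; toℕ; inject₁)
  open import Data.Product using (_×_; _,_)
  open import Data.Unit using (⊤; tt)
  open import Function using (_∘_; _⇔_; mk⇔)
  open import Relation.Nullary using (Dec; yes; no; does)
  open import Relation.Nullary.Decidable using (_×-dec_)
  open import Relation.Binary.PropositionalEquality
  open import Algebra.Properties.Semiring.Sum +-*-semiring using (sum; sum-cong-≗)
  open Counting using (𝟙)
  open VectorSums

  -- multichoose r m = number of weakly increasing sequences of length m in {0,…,r-1},
  -- i.e. the multiset coefficient ((r multichoose m)) = C(r+m-1, m).
  multichoose : ℕ → ℕ → ℕ
  multichoose r       zero    = 1
  multichoose zero    (suc m) = 0
  multichoose (suc r) (suc m) = multichoose r (suc m) + multichoose (suc r) m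

  -- Pascal's rule for multichoose (suc T ∸ d) (suc m), valid also when d > T because d ≤ m.
  multichoose-pascal : ∀ T d m → d ≤ m →
    multichoose (suc T ∸ d) (suc m) ≡ multichoose (suc T ∸ d) m + multichoose (T ∸ d) (suc m)
  multichoose-pascal T d m d≤m with d ≤? T
  ... | yes d≤T rewrite +-∸-assoc 1 d≤T = +-comm (multichoose (T ∸ d) (suc m)) _
  ... | no  d≰T rewrite m≤n⇒m∸n≡0 (≰⇒> d≰T) | m≤n⇒m∸n≡0 (<⇒≤ (≰⇒> d≰T)) =
    nothing-below-0 m (≤-trans (s≤s z≤n) (≤-trans (≰⇒> d≰T) d≤m))
    where
    nothing-below-0 : ∀ m → 0 < m → 0 ≡ multichoose 0 m + 0
    nothing-below-0 (suc m) _ = refl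

  -- Hockey-stick identity: summing the number of length-m sequences above each
  -- admissible first value a ≥ K gives the number of length-(m+1) sequences.
  hockey-stick : ∀ T K d m → d ≤ m →
    sum (λ (a : Fin T) → 𝟙 (does (K ≤? toℕ a)) * multichoose (T ∸ (toℕ a + d)) m)
      ≡ multichoose (T ∸ (K + d)) (suc m)
  hockey-stick zero    K       d m d≤m = cong (λ r → multichoose r (suc m)) (sym (0∸n≡0 (K + d)))
  hockey-stick (suc T) (suc K) d m d≤m =
    trans (sum-cong-≗ {T} λ a →
             cong (λ b → 𝟙 b * multichoose (T ∸ (toℕ a + d)) m) (suc≤?suc K (toℕ a)))
          (hockey-stick T K d m d≤m)
    where
    suc≤?suc : ∀ K x → does (suc K ≤? suc x) ≡ does (K ≤? x)
    suc≤?suc zero    x = refl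
    suc≤?suc (suc K) x = refl
  hockey-stick (suc T) zero    d m d≤m = begin
    (multichoose (suc T ∸ d) m + 0) + sum (λ (a : Fin T) → 1 * multichoose (T ∸ (toℕ a + d)) m)
      ≡⟨ cong₂ _+_ (+-identityʳ _) (hockey-stick T zero d m d≤m) ⟩
    multichoose (suc T ∸ d) m + multichoose (T ∸ d) (suc m)
      ≡⟨ multichoose-pascal T d m d≤m ⟨
    multichoose (suc T ∸ d) (suc m) ∎
    where open ≡-Reasoning

  Chain : ∀ {T} m → (Fin m → Bool) → ℕ → (Fin m → Fin T) → Set
  Chain zero    b L z = ⊤
  Chain (suc m) b L z = L + 𝟙 (b zero) ≤ toℕ (z zero) × Chain m (b ∘ suc) (toℕ (z zero)) (z ∘ suc)

  chain? : ∀ {T} m b L (z : Fin m → Fin T) → Dec (Chain m b L z)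
  chain? zero    b L z = yes tt
  chain? (suc m) b L z =
    (L + 𝟙 (b zero) ≤? toℕ (z zero)) ×-dec chain? m (b ∘ suc) (toℕ (z zero)) (z ∘ suc)

  𝟙-∧ : ∀ x y → 𝟙 (x ∧ y) ≡ 𝟙 x * 𝟙 y
  𝟙-∧ true  y = sym (+-identityʳ (𝟙 y))
  𝟙-∧ false y = refl

  𝟙-≤1 : ∀ x → 𝟙 x ≤ 1
  𝟙-≤1 true  = s≤s z≤n
  𝟙-≤1 false = z≤n

  sum-𝟙-≤ : ∀ m (b : Fin m → Bool) → sum (𝟙 ∘ b) ≤ m
  sum-𝟙-≤ zero    b = z≤n
  sum-𝟙-≤ (suc m) b = +-mono-≤ (𝟙-≤1 (b zero)) (sum-𝟙-≤ m (b ∘ suc))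

  -- Counting chains: subtracting the forced jumps turns chains in {0,…,T-1} into
  -- weakly increasing sequences, so there are multichoose (T ∸ (L + #jumps)) m of them.
  count-chains : ∀ T m b L →
    ∑ᵛ T m (λ z → 𝟙 (does (chain? m b L z))) ≡ multichoose (T ∸ (L + sum (𝟙 ∘ b))) m
  count-chains T zero    b L = refl
  count-chains T (suc m) b L = begin
    sum (λ a → ∑ᵛ T m (λ v → 𝟙 (does (first? a) ∧ does (chain? m b′ (toℕ a) v))))
      ≡⟨ sum-cong-≗ (λ a → ∑ᵛ-cong T m (λ v → 𝟙-∧ (does (first? a)) _)) ⟩
    sum (λ a → ∑ᵛ T m (λ v → 𝟙 (does (first? a)) * 𝟙 (does (chain? m b′ (toℕ a) v))))
      ≡⟨ sum-cong-≗ (λ a → ∑ᵛ-*ˡ T m (𝟙 (does (first? a))) _) ⟩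
    sum (λ a → 𝟙 (does (first? a)) * ∑ᵛ T m (λ v → 𝟙 (does (chain? m b′ (toℕ a) v))))
      ≡⟨ sum-cong-≗ (λ a → cong (𝟙 (does (first? a)) *_) (count-chains T m b′ (toℕ a))) ⟩
    sum (λ a → 𝟙 (does (first? a)) * multichoose (T ∸ (toℕ a + sum (𝟙 ∘ b′))) m)
      ≡⟨ hockey-stick T (L + β) (sum (𝟙 ∘ b′)) m (sum-𝟙-≤ m b′) ⟩
    multichoose (T ∸ (L + β + sum (𝟙 ∘ b′))) (suc m)
      ≡⟨ cong (λ s → multichoose (T ∸ s) (suc m)) (+-assoc L β _) ⟩
    multichoose (T ∸ (L + sum (𝟙 ∘ b))) (suc m) ∎
    where
    open ≡-Reasoning
    β  = 𝟙 (b zero)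
    b′ = b ∘ suc
    first? : (a : Fin T) → Dec (L + β ≤ toℕ a)
    first? a = L + β ≤? toℕ a

  Steps : ∀ {m} → (Fin m → Bool) → (Fin (suc m) → ℕ) → Set
  Steps b z = ∀ q → z (inject₁ q) + 𝟙 (b q) ≤ z (suc q)

  chain⇔steps : ∀ {T} m b L (z : Fin (suc m) → Fin T) →
    Chain (suc m) b L z ⇔ (L + 𝟙 (b zero) ≤ toℕ (z zero) × Steps (b ∘ suc) (toℕ ∘ z))
  chain⇔steps m b L z = mk⇔ (to m b L z) (from m b L z)
    where
    to : ∀ {T} m b L (z : Fin (suc m) → Fin T) →
      Chain (suc m) b L z → L + 𝟙 (b zero) ≤ toℕ (z zero) × Steps (b ∘ suc) (toℕ ∘ z)
    to zero    b L z (first , _)    = first , λ ()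
    to (suc m) b L z (first , rest) with to m (b ∘ suc) (toℕ (z zero)) (z ∘ suc) rest
    ... | second , steps = first , λ { zero → second ; (suc q) → steps q }
    from : ∀ {T} m b L (z : Fin (suc m) → Fin T) →
      L + 𝟙 (b zero) ≤ toℕ (z zero) × Steps (b ∘ suc) (toℕ ∘ z) → Chain (suc m) b L z
    from zero    b L z (first , _)     = first , tt
    from (suc m) b L z (first , steps) =
      first , from m (b ∘ suc) (toℕ (z zero)) (z ∘ suc) (steps zero , steps ∘ suc)

  Steps-resp : ∀ {m} {b b′ : Fin m → Bool} {z} → (∀ q → b q ≡ b′ q) → Steps b z → Steps b′ z
  Steps-resp {z = z} b≗b′ steps q =
    subst (λ β → z (inject₁ q) + 𝟙 β ≤ z (suc q)) (b≗b′ q) (steps q)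

module Descents where

  open import Data.Nat using (ℕ; zero; suc; _+_; _≤_; _<_; z≤n; s≤s)
  import Data.Nat.Properties as ℕP
  open import Data.Bool using (Bool)
  open import Data.Fin as Fin using (Fin; zero; suc; inject₁; toℕ)
  import Data.Fin.Properties as FinP
  open import Data.Product using (_×_; _,_; proj₁; proj₂)
  open import Function using (_∘_; _⇔_; mk⇔)
  open import Function.Definitions using (Injective)
  open import Relation.Nullary using (does; yes; no; contradiction)
  open import Relation.Nullary.Decidable using (dec-true; dec-false)
  open import Relation.Binary.Definitions using (tri<; tri≈; tri>)
  open import Relation.Binary.PropositionalEquality
  open Counting using (𝟙)
  open Chains using (Steps)

  descent : ∀ {m k} → (Fin (suc m) → Fin k) → Fin m → Bool
  descent c q = does (c (suc q) FinP.<? c (inject₁ q))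

  -- z orders positions the way cs orders coordinates: whenever c P < c Q,
  -- position Q precedes P exactly when z Q < z P.
  SortsLike : ∀ {m k} → (Fin m → Fin k) → (Fin m → ℕ) → Set
  SortsLike c z = ∀ P Q → c P Fin.< c Q → (Q Fin.< P → z Q < z P) × (z Q < z P → Q Fin.< P)

  module _ {m k} (c : Fin (suc m) → Fin k) (z : Fin (suc m) → ℕ) where

    step-weak : Steps (descent c) z → ∀ q → z (inject₁ q) ≤ z (suc q)
    step-weak steps q = ℕP.≤-trans (ℕP.m≤m+n _ _) (steps q)

    step-strict : Steps (descent c) z → ∀ q → c (suc q) Fin.< c (inject₁ q) → z (inject₁ q) < z (suc q)
    step-strict steps q drop = subst (_≤ z (suc q)) (ℕP.+-comm _ 1)
      (subst (λ b → z (inject₁ q) + 𝟙 b ≤ z (suc q))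
             (dec-true (c (suc q) FinP.<? c (inject₁ q)) drop) (steps q))

  -- Along steps that are strict at the descents of c, z is weakly increasing, and
  -- strictly increasing from P to Q when c Q < c P (some descent lies in between).
  steps-monotone : ∀ {m k} (c : Fin (suc m) → Fin k) (z : Fin (suc m) → ℕ) → Steps (descent c) z →
    ∀ {P Q} → P Fin.< Q → z P ≤ z Q × (c Q Fin.< c P → z P < z Q)
  steps-monotone c z steps {zero} {suc zero} _ = step-weak c z steps zero , step-strict c z steps zero
  steps-monotone {suc m} c z steps {zero} {suc (suc Q)} _ =
    ℕP.≤-trans (step-weak c z steps zero) (proj₁ later) , strict
    where
    later = steps-monotone (c ∘ suc) (z ∘ suc) (steps ∘ suc) {zero} {suc Q} (s≤s z≤n)
    strict : c (suc (suc Q)) Fin.< c zero → z zero < z (suc (suc Q))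
    strict cQ<c0 with c (suc zero) FinP.<? c zero
    ... | yes c1<c0 = ℕP.<-≤-trans (step-strict c z steps zero c1<c0) (proj₁ later)
    ... | no  c1≮c0 =
      ℕP.≤-<-trans (step-weak c z steps zero) (proj₂ later (ℕP.<-≤-trans cQ<c0 (ℕP.≮⇒≥ c1≮c0)))
  steps-monotone {suc m} c z steps {suc P} {suc Q} (s≤s P<Q) =
    steps-monotone (c ∘ suc) (z ∘ suc) (steps ∘ suc) P<Q

  steps⇔sortsLike : ∀ {m k} (c : Fin (suc m) → Fin k) → Injective _≡_ _≡_ c →
    (z : Fin (suc m) → ℕ) → Steps (descent c) z ⇔ SortsLike c z
  steps⇔sortsLike c c-inj z = mk⇔ steps⇒sorts sorts⇒steps
    where
    steps⇒sorts : Steps (descent c) z → SortsLike c z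
    steps⇒sorts steps P Q cP<cQ = (λ Q<P → proj₂ (steps-monotone c z steps Q<P) cP<cQ) , precedes
      where
      precedes : z Q < z P → Q Fin.< P
      precedes zQ<zP with FinP.<-cmp P Q
      ... | tri< P<Q _ _ = contradiction (proj₁ (steps-monotone c z steps P<Q)) (ℕP.<⇒≱ zQ<zP)
      ... | tri≈ _ refl _ = contradiction cP<cQ (ℕP.<-irrefl refl)
      ... | tri> _ _ Q<P = Q<P

    i<1+i : ∀ q → inject₁ q Fin.< suc q
    i<1+i q = s≤s (ℕP.≤-reflexive (FinP.toℕ-inject₁ q))

    sorts⇒steps : SortsLike c z → Steps (descent c) z
    sorts⇒steps sorts q with FinP.<-cmp (c (inject₁ q)) (c (suc q))
    ... | tri< rise _ _
      rewrite dec-false (c (suc q) FinP.<? c (inject₁ q)) (FinP.<-asym rise) =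
      subst (_≤ z (suc q)) (sym (ℕP.+-identityʳ _))
        (ℕP.≮⇒≥ λ drop → FinP.<-asym (proj₂ (sorts (inject₁ q) (suc q) rise) drop) (i<1+i q))
    ... | tri≈ _ same _ = contradiction (cong toℕ (c-inj same)) (ℕP.<⇒≢ (i<1+i q))
    ... | tri> _ _ drop rewrite dec-true (c (suc q) FinP.<? c (inject₁ q)) drop =
      subst (_≤ z (suc q)) (ℕP.+-comm 1 _) (proj₁ (sorts (suc q) (inject₁ q) drop) (i<1+i q))

module GridPoints where

  open import Data.Nat as ℕ using (ℕ; suc; z≤n)
  import Data.Nat.Properties as ℕP
  open import Data.Integer as ℤ using (+_; +<+; +≤+)
  import Data.Integer.Properties as ℤP
  open import Data.Rational as ℚ using (ℚ; _/_; toℚᵘ; fromℚᵘ)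
  import Data.Rational.Properties as ℚP
  open import Data.Rational.Unnormalised as ℚᵘ using (ℚᵘ; mkℚᵘ; *<*; *≤*)
  import Data.Rational.Unnormalised.Properties as ℚᵘP
  open import Relation.Binary.PropositionalEquality

  fromℚᵘ-mono-< : ∀ {u v} → u ℚᵘ.< v → fromℚᵘ u ℚ.< fromℚᵘ v
  fromℚᵘ-mono-< {u} {v} u<v = ℚP.toℚᵘ-cancel-<
    (ℚᵘP.<-respʳ-≃ (ℚᵘP.≃-sym (ℚP.toℚᵘ-fromℚᵘ v))
      (ℚᵘP.<-respˡ-≃ (ℚᵘP.≃-sym (ℚP.toℚᵘ-fromℚᵘ u)) u<v))

  fromℚᵘ-cancel-< : ∀ {u v} → fromℚᵘ u ℚ.< fromℚᵘ v → u ℚᵘ.< v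
  fromℚᵘ-cancel-< {u} {v} u<v =
    ℚᵘP.<-respʳ-≃ (ℚP.toℚᵘ-fromℚᵘ v) (ℚᵘP.<-respˡ-≃ (ℚP.toℚᵘ-fromℚᵘ u) (ℚP.toℚᵘ-mono-< u<v))

  fromℚᵘ-mono-≤ : ∀ {u v} → u ℚᵘ.≤ v → fromℚᵘ u ℚ.≤ fromℚᵘ v
  fromℚᵘ-mono-≤ {u} {v} u≤v = ℚP.toℚᵘ-cancel-≤
    (ℚᵘP.≤-respʳ-≃ (ℚᵘP.≃-sym (ℚP.toℚᵘ-fromℚᵘ v))
      (ℚᵘP.≤-respˡ-≃ (ℚᵘP.≃-sym (ℚP.toℚᵘ-fromℚᵘ u)) u≤v))

  grid-< : ∀ t {a c} → a ℕ.< c → (+ a / suc t) ℚ.< (+ c / suc t)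
  grid-< t {a} {c} a<c = fromℚᵘ-mono-< {mkℚᵘ (+ a) t} {mkℚᵘ (+ c) t}
    (*<* (subst₂ ℤ._<_ (ℤP.pos-* a (suc t)) (ℤP.pos-* c (suc t)) (+<+ (ℕP.*-monoˡ-< (suc t) a<c))))

  grid-<⁻¹ : ∀ t {a c} → (+ a / suc t) ℚ.< (+ c / suc t) → a ℕ.< c
  grid-<⁻¹ t {a} {c} a/<c/ with fromℚᵘ-cancel-< {mkℚᵘ (+ a) t} {mkℚᵘ (+ c) t} a/<c/
  ... | *<* a*<c* with subst₂ ℤ._<_ (sym (ℤP.pos-* a (suc t))) (sym (ℤP.pos-* c (suc t))) a*<c*
  ... | +<+ a*<c*ℕ = ℕP.*-cancelʳ-< (suc t) a c a*<c*ℕ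

  grid-≥0 : ∀ t a → ℚ.0ℚ ℚ.≤ (+ a / suc t)
  grid-≥0 t a = fromℚᵘ-mono-≤ {mkℚᵘ (+ 0) 0} {mkℚᵘ (+ a) t}
    (*≤* (subst (ℤ._≤_ (+ 0)) (sym (ℤP.*-identityʳ (+ a))) (+≤+ z≤n)))

  grid-<1 : ∀ t {a} → a ℕ.< suc t → (+ a / suc t) ℚ.< ℚ.1ℚ
  grid-<1 t {a} a<1+t = fromℚᵘ-mono-< {mkℚᵘ (+ a) t} {mkℚᵘ (+ 1) 0}
    (*<* (subst₂ ℤ._<_ (ℤP.pos-* a 1) (ℤP.pos-* 1 (suc t))
      (+<+ (subst₂ ℕ._<_ (sym (ℕP.*-identityʳ a)) (sym (ℕP.*-identityˡ (suc t))) a<1+t))))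

module WordCoordinates where

  open import Data.Nat as ℕ using (ℕ; zero; suc; z≤n; s≤s)
  import Data.Nat.Properties as ℕP
  open import Data.Bool using (false)
  open import Data.Fin as Fin using (Fin; zero; suc; toℕ; inject₁; punchOut)
  import Data.Fin.Properties as FinP
  open import Data.Fin.Permutation using (Permutation; permutation; _⟨$⟩ʳ_)
  open import Data.Product using (∃; _,_; proj₁; proj₂)
  open import Data.Integer using (+_)
  open import Data.Rational as ℚ using (ℚ; _/_)
  open import Function using (_∘_; _⇔_; mk⇔; Equivalence)
  open import Function.Definitions using (Injective)
  open import Relation.Nullary using (yes; no; contradiction)
  open import Relation.Nullary.Decidable using (dec-false; does-⇔)
  open import Relation.Binary.PropositionalEquality
  open Counting using (𝟙)
  open Chains using (Chain; chain⇔steps; Steps-resp)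
  open Descents
  open GridPoints

  injective⇒surjective : ∀ {m} (f : Fin m → Fin m) → Injective _≡_ _≡_ f → ∀ j → ∃ λ i → f i ≡ j
  injective⇒surjective {zero}  f f-inj ()
  injective⇒surjective {suc m} f f-inj j with FinP.any? (λ i → f i FinP.≟ j)
  ... | yes hit = hit
  ... | no  miss = contradiction (FinP.injective⇒≤ g-inj) (ℕP.<-irrefl refl)
    where
    -- missing j, f factors through Fin m
    g : Fin (suc m) → Fin m
    g i = punchOut {i = j} {j = f i} (λ j≡fi → miss (i , sym j≡fi))
    g-inj : Injective _≡_ _≡_ g
    g-inj {x} {y} gx≡gy =
      f-inj (FinP.punchOut-injective (λ e → miss (x , sym e)) (λ e → miss (y , sym e)) gx≡gy)

  -- The coordinates of a word w = (w₀,…,w_{m+1}) from 0: position p+1 carries the letter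
  -- suc (τ p), i.e. the coordinate y_{τ p}; ρ is the inverse map coordinate ↦ position.
  module WordFrom0 {m} (w : Fin (suc (suc m)) → Fin (suc (suc m)))
                   (w-inj : Injective _≡_ _≡_ w) (w0 : w zero ≡ zero) where

    nonzero : ∀ p → zero ≢ w (suc p)
    nonzero p 0≡wp with w-inj (trans w0 0≡wp)
    ... | ()

    τ : Fin (suc m) → Fin (suc m)
    τ p = punchOut (nonzero p)

    w-suc : ∀ p → w (suc p) ≡ suc (τ p)
    w-suc p = sym (FinP.punchIn-punchOut (nonzero p))

    τ-inj : Injective _≡_ _≡_ τ
    τ-inj {p} {q} τp≡τq =
      FinP.suc-injective (w-inj (trans (w-suc p) (trans (cong suc τp≡τq) (sym (w-suc q)))))

    ρ : Fin (suc m) → Fin (suc m)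
    ρ i = proj₁ (injective⇒surjective τ τ-inj i)

    τ∘ρ : ∀ i → τ (ρ i) ≡ i
    τ∘ρ i = proj₂ (injective⇒surjective τ τ-inj i)

    ρ∘τ : ∀ p → ρ (τ p) ≡ p
    ρ∘τ p = τ-inj (τ∘ρ (τ p))

    position : Permutation (suc m) (suc m)
    position = permutation ρ τ ρ∘τ τ∘ρ

    descent-head : descent w zero ≡ false
    descent-head = dec-false (w (suc zero) FinP.<? w (inject₁ zero))
      (λ w1<w0 → ℕP.n≮0 (subst (λ v → toℕ (w (suc zero)) ℕ.< toℕ v) w0 w1<w0))

    w-suc-<⇔ : ∀ a b → w (suc a) Fin.< w (suc b) ⇔ τ a Fin.< τ b
    w-suc-<⇔ a b = mk⇔
      (λ lt → ℕP.≤-pred (subst₂ Fin._<_ (w-suc a) (w-suc b) lt))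
      (λ lt → subst₂ Fin._<_ (sym (w-suc a)) (sym (w-suc b)) (s≤s lt))

    descent-shift : ∀ q → descent w (suc q) ≡ descent τ q
    descent-shift q = does-⇔ (w-suc-<⇔ (suc q) (inject₁ q))
      (w (suc (suc q)) FinP.<? w (suc (inject₁ q))) (τ (suc q) FinP.<? τ (inject₁ q))

    appearsAfter⇔ : ∀ P Q → AppearsAfter w (suc (τ P)) (suc (τ Q)) ⇔ Q Fin.< P
    appearsAfter⇔ P Q = mk⇔ to (λ Q<P → suc P , suc Q , w-suc P , w-suc Q , s≤s Q<P)
      where
      to : AppearsAfter w (suc (τ P)) (suc (τ Q)) → Q Fin.< P
      to (p , q , wp≡ , wq≡ , q<p)
        with w-inj (trans wp≡ (sym (w-suc P))) | w-inj (trans wq≡ (sym (w-suc Q)))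
      ... | refl | refl = ℕP.≤-pred q<p

    -- A lattice point of (t+1)·[0,1)ⁿ listed by word positions: z P is the value of
    -- coordinate τ P, and point z is the corresponding point of [0,1)ⁿ.
    module _ {t} (z : Fin (suc m) → Fin (suc t)) where

      point : Fin (suc m) → ℚ
      point = scale t (z ∘ (position ⟨$⟩ʳ_))

      point-τ : ∀ P → point (τ P) ≡ + toℕ (z P) / suc t
      point-τ P = cong (λ Q → + toℕ (z Q) / suc t) (ρ∘τ P)

      appearsAfter-coords⇔ : ∀ i j → AppearsAfter w (suc i) (suc j) ⇔ ρ j Fin.< ρ i
      appearsAfter-coords⇔ i j = subst₂ (λ a b → AppearsAfter w (suc a) (suc b) ⇔ ρ j Fin.< ρ i)
        (τ∘ρ i) (τ∘ρ j) (appearsAfter⇔ (ρ i) (ρ j))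

      inS⇔sortsLike : InS (suc m) w point ⇔ SortsLike τ (toℕ ∘ z)
      inS⇔sortsLike = mk⇔ inS⇒sorts sorts⇒inS
        where
        inS⇒sorts : InS (suc m) w point → SortsLike τ (toℕ ∘ z)
        inS⇒sorts (_ , cs) P Q τP<τQ = precedes⇒< , <⇒precedes
          where
          appears⇒< = proj₁ (cs (τ P) (τ Q) τP<τQ)
          <⇒appears = proj₂ (cs (τ P) (τ Q) τP<τQ)
          precedes⇒< : Q Fin.< P → toℕ (z Q) ℕ.< toℕ (z P)
          precedes⇒< Q<P = grid-<⁻¹ t (subst₂ ℚ._<_ (point-τ Q) (point-τ P)
            (appears⇒< (Equivalence.from (appearsAfter⇔ P Q) Q<P)))
          <⇒precedes : toℕ (z Q) ℕ.< toℕ (z P) → Q Fin.< P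
          <⇒precedes zQ<zP = Equivalence.to (appearsAfter⇔ P Q)
            (<⇒appears (subst₂ ℚ._<_ (sym (point-τ Q)) (sym (point-τ P)) (grid-< t zQ<zP)))
        sorts⇒inS : SortsLike τ (toℕ ∘ z) → InS (suc m) w point
        sorts⇒inS sorts = (λ i → grid-≥0 t (toℕ (z (ρ i))) , grid-<1 t (FinP.toℕ<n (z (ρ i)))) , cs
          where
          cs : CsIs (suc m) point w
          cs i j i<j =
            (λ aa → grid-< t (proj₁ ordered (Equivalence.to (appearsAfter-coords⇔ i j) aa))) ,
            (λ lt → Equivalence.from (appearsAfter-coords⇔ i j) (proj₂ ordered (grid-<⁻¹ t lt)))
            where
            ordered = sorts (ρ i) (ρ j) (subst₂ Fin._<_ (sym (τ∘ρ i)) (sym (τ∘ρ j)) i<j)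

      inS⇔chain : InS (suc m) w point ⇔ Chain (suc m) (descent w) 0 z
      inS⇔chain = mk⇔
        (λ ins → Equivalence.from chain⇔
          ( subst (λ b → 𝟙 b ℕ.≤ toℕ (z zero)) (sym descent-head) z≤n
          , Steps-resp {z = toℕ ∘ z} (sym ∘ descent-shift)
              (Equivalence.from steps⇔sorts (Equivalence.to inS⇔sortsLike ins))))
        (λ chain → Equivalence.from inS⇔sortsLike (Equivalence.to steps⇔sorts
          (Steps-resp {z = toℕ ∘ z} descent-shift (proj₂ (Equivalence.to chain⇔ chain)))))
        where
        chain⇔ = chain⇔steps m (descent w) 0 z
        steps⇔sorts = steps⇔sortsLike τ τ-inj (toℕ ∘ z)

module FiniteDifferences where

  open import Data.Nat using (ℕ; zero; suc; _∸_)
  open import Data.Integer using (ℤ; +_; -_; _+_; _*_; _-_)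
  open import Data.Integer.Properties using (+-assoc; +-identityʳ; *-identityˡ)
  open import Data.Integer.Tactic.RingSolver using (solve-∀)
  open import Relation.Binary.PropositionalEquality

  sumTo-cong : ∀ k {f g : ℕ → ℤ} → (∀ i → f i ≡ g i) → sumTo k f ≡ sumTo k g
  sumTo-cong zero    f≗g = f≗g 0
  sumTo-cong (suc k) f≗g = cong₂ _+_ (sumTo-cong k f≗g) (f≗g (suc k))

  sumTo-head : ∀ k (f : ℕ → ℤ) → sumTo (suc k) f ≡ f 0 + sumTo k (λ i → f (suc i))
  sumTo-head zero    f = refl
  sumTo-head (suc k) f = trans (cong (_+ f (suc (suc k))) (sumTo-head k f)) (+-assoc (f 0) _ _)

  sumTo-only-head : ∀ k (f : ℕ → ℤ) → (∀ i → f (suc i) ≡ + 0) → sumTo k f ≡ f 0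
  sumTo-only-head zero    f tail≡0 = refl
  sumTo-only-head (suc k) f tail≡0 =
    trans (cong₂ _+_ (sumTo-only-head k f tail≡0) (tail≡0 k)) (+-identityʳ (f 0))

  sumTo-- : ∀ k (f g : ℕ → ℤ) → sumTo k (λ i → f i - g i) ≡ sumTo k f - sumTo k g
  sumTo-- zero    f g = refl
  sumTo-- (suc k) f g = begin
    sumTo k (λ i → f i - g i) + (f (suc k) - g (suc k))
      ≡⟨ cong (_+ (f (suc k) - g (suc k))) (sumTo-- k f g) ⟩
    (sumTo k f - sumTo k g) + (f (suc k) - g (suc k))
      ≡⟨ regroup (sumTo k f) (sumTo k g) (f (suc k)) (g (suc k)) ⟩
    (sumTo k f + f (suc k)) - (sumTo k g + g (suc k)) ∎
    where
    open ≡-Reasoning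
    regroup : ∀ a b c d → (a - b) + (c - d) ≡ (a + c) - (b + d)
    regroup = solve-∀

  Δ : Series → Series
  Δ g zero    = g zero
  Δ g (suc k) = g (suc k) - g k

  Δ^ : ℕ → Series → Series
  Δ^ zero    g = g
  Δ^ (suc m) g = Δ (Δ^ m g)

  Δ-cong : ∀ {g h : Series} → (∀ k → g k ≡ h k) → ∀ k → Δ g k ≡ Δ h k
  Δ-cong g≗h zero    = g≗h zero
  Δ-cong g≗h (suc k) = cong₂ _-_ (g≗h (suc k)) (g≗h k)

  Δ^-cong : ∀ m {g h : Series} → (∀ k → g k ≡ h k) → ∀ k → Δ^ m g k ≡ Δ^ m h k
  Δ^-cong zero    g≗h = g≗h
  Δ^-cong (suc m) g≗h = Δ-cong (Δ^-cong m g≗h)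

  ⊛-congˡ : ∀ {f f′ : Series} (g : Series) → (∀ i → f i ≡ f′ i) → ∀ k → (f ⊛ g) k ≡ (f′ ⊛ g) k
  ⊛-congˡ g f≗f′ k = sumTo-cong k (λ i → cong (_* g (k ∸ i)) (f≗f′ i))

  oneMinusZ-⊛ : ∀ (f : Series) k → (oneMinusZ ⊛ f) k ≡ Δ f k
  oneMinusZ-⊛ f zero    = *-identityˡ (f 0)
  oneMinusZ-⊛ f (suc k) = begin
    sumTo (suc k) (λ i → oneMinusZ i * f (suc k ∸ i))
      ≡⟨ sumTo-head k _ ⟩
    + 1 * f (suc k) + sumTo k (λ i → oneMinusZ (suc i) * f (k ∸ i))
      ≡⟨ cong (λ s → + 1 * f (suc k) + s) (sumTo-only-head k _ (λ i → refl)) ⟩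
    + 1 * f (suc k) + - + 1 * f k
      ≡⟨ simplify (f (suc k)) (f k) ⟩
    f (suc k) - f k ∎
    where
    open ≡-Reasoning
    simplify : ∀ a b → + 1 * a + - + 1 * b ≡ a - b
    simplify = solve-∀

  Δ-⊛ : ∀ (f g : Series) k → (Δ f ⊛ g) k ≡ Δ (f ⊛ g) k
  Δ-⊛ f g zero    = refl
  Δ-⊛ f g (suc k) = begin
    sumTo (suc k) (λ i → Δ f i * g (suc k ∸ i))
      ≡⟨ sumTo-head k _ ⟩
    f 0 * g (suc k) + sumTo k (λ i → (f (suc i) - f i) * g (k ∸ i))
      ≡⟨ cong (λ s → f 0 * g (suc k) + s)
              (sumTo-cong k (λ i → distrib (f (suc i)) (f i) (g (k ∸ i)))) ⟩
    f 0 * g (suc k) + sumTo k (λ i → f (suc i) * g (k ∸ i) - f i * g (k ∸ i))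
      ≡⟨ cong (λ s → f 0 * g (suc k) + s) (sumTo-- k _ _) ⟩
    f 0 * g (suc k) + (sumTo k (λ i → f (suc i) * g (k ∸ i)) - (f ⊛ g) k)
      ≡⟨ +-assoc (f 0 * g (suc k)) _ _ ⟨
    (f 0 * g (suc k) + sumTo k (λ i → f (suc i) * g (k ∸ i))) - (f ⊛ g) k
      ≡⟨ cong (_- (f ⊛ g) k) (sumTo-head k (λ i → f i * g (suc k ∸ i))) ⟨
    Δ (f ⊛ g) (suc k) ∎
    where
    open ≡-Reasoning
    distrib : ∀ a b c → (a - b) * c ≡ a * c - b * c
    distrib = solve-∀

  oneMinusZ^-⊛ : ∀ m (g : Series) k → ((oneMinusZ ^S m) ⊛ g) k ≡ Δ^ m g k
  oneMinusZ^-⊛ zero    g k = trans (sumTo-only-head k _ (λ i → refl)) (*-identityˡ (g k))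
  oneMinusZ^-⊛ (suc m) g k = begin
    ((oneMinusZ ⊛ (oneMinusZ ^S m)) ⊛ g) k ≡⟨ ⊛-congˡ g (oneMinusZ-⊛ (oneMinusZ ^S m)) k ⟩
    (Δ (oneMinusZ ^S m) ⊛ g) k            ≡⟨ Δ-⊛ (oneMinusZ ^S m) g k ⟩
    Δ ((oneMinusZ ^S m) ⊛ g) k            ≡⟨ Δ-cong (oneMinusZ^-⊛ m g) k ⟩
    Δ^ (suc m) g k ∎
    where open ≡-Reasoning

module MultichooseSeries where

  open import Data.Nat using (ℕ; zero; suc; _∸_; _≤?_; s≤s)
  import Data.Nat as ℕ
  import Data.Nat.Properties as ℕP
  open import Data.Integer using (+_; _+_; _-_)
  open import Data.Integer.Properties using (pos-+)
  open import Data.Integer.Tactic.RingSolver using (solve-∀)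
  open import Relation.Nullary using (yes; no; does; contradiction)
  open import Relation.Nullary.Decidable using (dec-true; dec-false)
  open import Relation.Binary.Definitions using (tri<; tri≈; tri>)
  open import Relation.Binary.PropositionalEquality
  open Counting using (𝟙)
  open Chains using (multichoose)
  open FiniteDifferences

  -- The series t ↦ ((t ∸ d multichoose m)); it will turn out to be the Ehrhart series.
  shiftedMultichoose : ℕ → ℕ → Series
  shiftedMultichoose d m t = + multichoose (t ∸ d) m

  +[a+b]-+a : ∀ a b → + (a ℕ.+ b) - + a ≡ + b
  +[a+b]-+a a b = trans (cong (_- + a) (pos-+ a b)) (cancel (+ a) (+ b))
    where
    cancel : ∀ x y → (x + y) - x ≡ y
    cancel = solve-∀

  Δ-shiftedMultichoose : ∀ d m t →
    Δ (shiftedMultichoose d (suc (suc m))) t ≡ shiftedMultichoose d (suc m) t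
  Δ-shiftedMultichoose d m zero rewrite ℕP.0∸n≡0 d = refl
  Δ-shiftedMultichoose d m (suc t) with d ≤? t
  ... | yes d≤t rewrite ℕP.+-∸-assoc 1 d≤t = +[a+b]-+a (multichoose (t ∸ d) (suc (suc m))) _
  ... | no  d≰t rewrite ℕP.m≤n⇒m∸n≡0 (ℕP.≰⇒> d≰t) | ℕP.m≤n⇒m∸n≡0 (ℕP.<⇒≤ (ℕP.≰⇒> d≰t)) = refl

  Δ-ramp : ∀ d t → Δ (shiftedMultichoose d 1) t ≡ + 𝟙 (does (suc d ≤? t))
  Δ-ramp d zero rewrite ℕP.0∸n≡0 d = refl
  Δ-ramp d (suc t) with d ≤? t
  ... | yes d≤t rewrite ℕP.+-∸-assoc 1 d≤t | dec-true (suc d ≤? suc t) (s≤s d≤t) =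
    +[a+b]-+a (multichoose (t ∸ d) 1) 1
  ... | no  d≰t rewrite ℕP.m≤n⇒m∸n≡0 (ℕP.≰⇒> d≰t) | ℕP.m≤n⇒m∸n≡0 (ℕP.<⇒≤ (ℕP.≰⇒> d≰t))
                      | dec-false (suc d ≤? suc t) (λ d<1+t → d≰t (ℕP.≤-pred d<1+t)) = refl

  zPow-diag : ∀ d → zPow d d ≡ + 1
  zPow-diag d with d ℕ.≟ d
  ... | yes _   = refl
  ... | no  d≢d = contradiction refl d≢d

  zPow-off : ∀ d k → d ≢ k → zPow d k ≡ + 0
  zPow-off d k d≢k with d ℕ.≟ k
  ... | yes d≡k = contradiction d≡k d≢k
  ... | no  _   = refl

  Δ-step : ∀ d t → Δ (λ t → + 𝟙 (does (suc d ≤? t))) t ≡ zPow (suc d) t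
  Δ-step d zero = sym (zPow-off (suc d) zero λ ())
  Δ-step d (suc t) with ℕP.<-cmp d t
  ... | tri< d<t _ _
    rewrite dec-true (suc d ≤? suc t) (ℕP.m<n⇒m<1+n d<t) | dec-true (suc d ≤? t) d<t =
    sym (zPow-off (suc d) (suc t) (λ e → ℕP.<⇒≢ d<t (ℕP.suc-injective e)))
  ... | tri≈ _ refl _
    rewrite dec-true (suc d ≤? suc d) ℕP.≤-refl | dec-false (suc d ≤? d) (ℕP.n≮n d) =
    sym (zPow-diag (suc d))
  ... | tri> _ _ t<d
    rewrite dec-false (suc d ≤? suc t) (ℕP.<⇒≱ (s≤s t<d))
          | dec-false (suc d ≤? t) (ℕP.<⇒≱ (ℕP.m<n⇒m<1+n t<d)) =
    sym (zPow-off (suc d) (suc t) (λ e → ℕP.<⇒≢ t<d (sym (ℕP.suc-injective e))))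

  Δ^-shiftedMultichoose : ∀ d j m t →
    Δ^ j (shiftedMultichoose d (suc m ℕ.+ j)) t ≡ shiftedMultichoose d (suc m) t
  Δ^-shiftedMultichoose d zero    m t rewrite ℕP.+-identityʳ m = refl
  Δ^-shiftedMultichoose d (suc j) m t rewrite ℕP.+-suc m j =
    trans (Δ-cong (Δ^-shiftedMultichoose d j (suc m)) t) (Δ-shiftedMultichoose d m t)

  Δ^-shiftedMultichoose-impulse : ∀ d m t →
    Δ^ (suc (suc m)) (shiftedMultichoose d (suc m)) t ≡ zPow (suc d) t
  Δ^-shiftedMultichoose-impulse d m t = begin
    Δ (Δ (Δ^ m (shiftedMultichoose d (suc m)))) t
      ≡⟨ Δ-cong (Δ-cong (Δ^-shiftedMultichoose d m 0)) t ⟩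
    Δ (Δ (shiftedMultichoose d 1)) t
      ≡⟨ Δ-cong (Δ-ramp d) t ⟩
    Δ (λ t → + 𝟙 (does (suc d ≤? t))) t
      ≡⟨ Δ-step d t ⟩
    zPow (suc d) t ∎
    where open ≡-Reasoning

open import Data.Nat using (zero; _∸_)
open import Data.Nat.Properties using (+-*-semiring; 0∸n≡0)
open import Data.Fin using (zero; suc; toℕ; inject₁)
open import Data.Fin.Properties using (_<?_)
open import Data.Product using (_×_; _,_; proj₁; proj₂)
open import Data.Integer using (+_)
open import Data.Rational as ℚ using (ℚ)
open import Data.Vec.Functional using (Vector)
open import Function using (_∘_)
open import Relation.Nullary using (does)
open import Relation.Nullary.Decidable using (does-⇔)
open import Relation.Binary.PropositionalEquality
open import Algebra.Properties.Semiring.Sum +-*-semiring using (sum)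
open VectorSums
open Counting
open Chains
open Descents
open FiniteDifferences
open MultichooseSeries
open WordCoordinates

InS-resp : ∀ n w {y y′ : Vector ℚ n} → y ≗ y′ → InS n w y → InS n w y′
InS-resp n w y≗y′ (bounds , cs) =
  (λ i → subst (λ v → ℚ.0ℚ ℚ.≤ v × v ℚ.< ℚ.1ℚ) (y≗y′ i) (bounds i)) ,
  (λ i j i<j → (λ aa → subst₂ ℚ._<_ (y≗y′ j) (y≗y′ i) (proj₁ (cs i j i<j) aa)) ,
               (λ lt → proj₂ (cs i j i<j) (subst₂ ℚ._<_ (sym (y≗y′ j)) (sym (y≗y′ i)) lt)))

InScaled-resp : ∀ n w t {x x′ : Vector (Fin (suc t)) n} → x ≗ x′ →
  InS n w (scale t x) → InS n w (scale t x′)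
InScaled-resp n w t x≗x′ = InS-resp n w (λ i → cong (λ v → + toℕ v ℚ./ suc t) (x≗x′ i))

des≡sum : ∀ n w → des n w ≡ sum (𝟙 ∘ descent w)
des≡sum n w = count-tabulate (λ i → w (suc i) <? w (inject₁ i)) (λ i → i)

E-multichoose : ∀ m w → IsWordFrom0 (suc m) w →
  ∀ t → E (suc m) w t ≡ multichoose (t ∸ des (suc m) w) (suc m)
E-multichoose m w word zero = cong (λ r → multichoose r (suc m)) (sym (0∸n≡0 (des (suc m) w)))
E-multichoose m w (w-inj , w0) (suc t) = begin
  count (inS? (suc m) w ∘ scale t) (allVectors (suc m) (suc t))
    ≡⟨ count-allVectors (suc m) (suc t) (inS? (suc m) w ∘ scale t) (InScaled-resp (suc m) w t) ⟩
  ∑ᵛ (suc t) (suc m) (λ x → 𝟙 (does (inS? (suc m) w (scale t x))))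
    ≡⟨ ∑ᵛ-reindex (suc t) (suc m) position
         (λ x → 𝟙 (does (inS? (suc m) w (scale t x))))
         (λ z → 𝟙 (does (chain? (suc m) (descent w) 0 z)))
         (λ x≗y → cong 𝟙 (does-≗ (inS? (suc m) w ∘ scale t) (InScaled-resp (suc m) w t) x≗y))
         (λ z → cong 𝟙 (does-⇔ (inS⇔chain z) (inS? (suc m) w (point z))
                                              (chain? (suc m) (descent w) 0 z))) ⟩
  ∑ᵛ (suc t) (suc m) (λ z → 𝟙 (does (chain? (suc m) (descent w) 0 z)))
    ≡⟨ count-chains (suc t) (suc m) (descent w) 0 ⟩
  multichoose (suc t ∸ sum (𝟙 ∘ descent w)) (suc m)
    ≡⟨ cong (λ d → multichoose (suc t ∸ d) (suc m)) (des≡sum (suc m) w) ⟨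
  multichoose (suc t ∸ des (suc m) w) (suc m) ∎
  where
  open ≡-Reasoning
  open WordFrom0 w w-inj w0

lemma5p4 : (n : ℕ) → 1 ≤ n →
    (R : Fin (suc n) → Fin (suc n) → Fin (suc n) → Set) → IsTotalCyclicOrder R →
    (w : Fin (suc n) → Fin (suc n)) → IsWordOf n R w →
    ∀ k → Estar n w k ≡ zPow (suc (des n w)) k
lemma5p4 (suc m) _ _ _ w (word , _) k = begin
  ((oneMinusZ ^S suc n) ⊛ EhrSeries n w) k
    ≡⟨ oneMinusZ^-⊛ (suc n) (EhrSeries n w) k ⟩
  Δ^ (suc n) (EhrSeries n w) k
    ≡⟨ Δ^-cong (suc n) (λ t → cong +_ (E-multichoose m w word t)) k ⟩
  Δ^ (suc n) (shiftedMultichoose (des n w) n) k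
    ≡⟨ Δ^-shiftedMultichoose-impulse (des n w) m k ⟩
  zPow (suc (des n w)) k ∎
  where
  open ≡-Reasoning
  n = suc m
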